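{- Let $G$ be a finite simple graph with vertex set $V=\{v_1,\dots,v_n\}$ and edge set $E$, and let $\mathbb{k}=GF(2)$. The following are equivalent: (1) $N_{\mathbb{k}}(G)=1$. (2) $1$ is a $\mathbb{k}$-linear combination of the polynomials $x_i^3+1$ for all $v_i\in V$ and $x_k(x_i^2+x_ix_j+x_j^2)$ for all $v_iv_j\in E$, $v_k\in V$. (3) $1$ is a $\mathbb{k}$-linear combination of the polynomials $x_i^2x_j+x_ix_j^2+1$ for all $v_iv_j\in E$ and $x_i^2x_k+x_ix_jx_k+x_j^2x_k$ for all $v_iv_j\in E$ and $v_k\in V$ with $v_k\neq v_i$, $v_k\neq v_j$. (4) $1$ is a $\mathbb{k}$-linear combination of the polynomials $x_i^2x_j+x_ix_j^2+1$ for all $v_iv_j\in E$ and $x_i^2x_k+x_j^2x_k+x_ix_j^2+x_ix_k^2$ for all $v_i,v_j,v_k$ with $v_iv_j\in E$ and $v_jv_k\in E$.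
   Context: Bayer's formulation of 3-colorability of $G$ over a field $\mathbb{k}$ is the system in $\mathbb{k}[x_1,\dots,x_n]$ consisting of $x_i^3-1=0$ for every vertex $v_i$ and $x_i^2+x_ix_j+x_j^2=0$ for every edge $v_iv_j\in E$; for $\mathrm{char}(\mathbb{k})\neq3$ it has a solution over $\overline{\mathbb{k}}$ iff $G$ is 3-colorable. A Nullstellensatz certificate for a system $f_1=\dots=f_s=0$ is a tuple $\alpha_1,\dots,\alpha_s\in\mathbb{k}[x_1,\dots,x_n]$ with $1=\sum_i\alpha_if_i$, of degree $\max_i\deg\alpha_i$. $N_{\mathbb{k}}(G)$ is the minimum degree of a Nullstellensatz certificate for Bayer's formulation of $G$ over $\mathbb{k}$ (undefined, in particular not equal to $1$, if $G$ is 3-colorable). -}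

module Defs where

open import Data.Bool using (Bool; true; false; not; if_then_else_; _∧_)
open import Data.Nat using (ℕ; zero; suc; _+_; _≤_; _<ᵇ_)
import Data.Nat.Properties as ℕP
open import Data.Fin using (Fin; toℕ)
import Data.Fin.Properties as FinP
open import Data.Vec using (Vec; zipWith; replicate; tabulate)
import Data.Vec as Vec
open import Data.Vec.Properties using (≡-dec)
open import Data.List using (List; []; _∷_; _++_; map; concatMap; concat; allFin; foldr)
open import Data.Product using (Σ; _×_; _,_)
open import Relation.Nullary using (¬_)
open import Relation.Nullary.Decidable using (⌊_⌋)
open import Relation.Binary.PropositionalEquality using (_≡_)

-- A monomial is its exponent vector; a polynomial is a finite list of
-- monomials, read as their sum over GF(2) (so the coefficient of a
-- monomial is the parity of its number of occurrences).  Two lists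
-- represent the same polynomial iff all coefficients agree (_≈_).

Monomial : ℕ → Set
Monomial n = Vec ℕ n

Poly : ℕ → Set
Poly n = List (Monomial n)

module _ {n : ℕ} where

  coeff : Poly n → Monomial n → Bool
  coeff p m = foldr (λ m' b → if ⌊ ≡-dec ℕP._≟_ m' m ⌋ then not b else b) false p

  infix 4 _≈_
  _≈_ : Poly n → Poly n → Set
  p ≈ q = ∀ m → coeff p m ≡ coeff q m

  𝟘 : Poly n
  𝟘 = []

  𝟙 : Poly n
  𝟙 = replicate n 0 ∷ []

  infixl 6 _⊕_
  _⊕_ : Poly n → Poly n → Poly n
  p ⊕ q = p ++ q

  infixl 7 _⊗_
  _⊗_ : Poly n → Poly n → Poly n
  p ⊗ q = concatMap (λ a → map (zipWith _+_ a) q) p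

  X : Fin n → Poly n
  X i = tabulate (λ j → if ⌊ i FinP.≟ j ⌋ then 1 else 0) ∷ []

  scal : Bool → Poly n → Poly n
  scal c p = if c then p else 𝟘

  ΣFin : (Fin n → Poly n) → Poly n
  ΣFin f = concat (map f (allFin n))

  totalDegree : Monomial n → ℕ
  totalDegree m = Vec.sum m

  DegreeAtMost : ℕ → Poly n → Set
  DegreeAtMost d p = ∀ m → coeff p m ≡ true → totalDegree m ≤ d

record SimpleGraph (n : ℕ) : Set where
  field
    adj    : Fin n → Fin n → Bool
    sym    : ∀ i j → adj i j ≡ adj j i
    irrefl : ∀ i → adj i i ≡ false

open SimpleGraph public

module _ {n : ℕ} where

  -- i < j as Booleans (each unordered edge {i,j} is listed once, as i < j)
  _≺_ : Fin n → Fin n → Bool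
  i ≺ j = toℕ i <ᵇ toℕ j

  isEdge< : SimpleGraph n → Fin n → Fin n → Bool
  isEdge< G i j = adj G i j ∧ (i ≺ j)

  neq : Fin n → Fin n → Bool
  neq i j = not ⌊ i FinP.≟ j ⌋

  -- Bayer's polynomials over GF(2): x_i^3 - 1 = x_i^3 + 1 and x_i^2 + x_i x_j + x_j^2
  vertexPoly : Fin n → Poly n
  vertexPoly i = X i ⊗ X i ⊗ X i ⊕ 𝟙

  edgePoly : Fin n → Fin n → Poly n
  edgePoly i j = X i ⊗ X i ⊕ X i ⊗ X j ⊕ X j ⊗ X j

  HasCertificateOfDegreeAtMost : SimpleGraph n → ℕ → Set
  HasCertificateOfDegreeAtMost G d =
    Σ (Fin n → Poly n) λ α →
    Σ (Fin n → Fin n → Poly n) λ β →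
      (∀ i → DegreeAtMost d (α i)) ×
      (∀ i j → DegreeAtMost d (β i j)) ×
      (𝟙 ≈ ΣFin (λ i → α i ⊗ vertexPoly i)
           ⊕ ΣFin (λ i → ΣFin (λ j → scal (isEdge< G i j) (β i j ⊗ edgePoly i j))))

  -- N_{GF(2)}(G) = 1 : the minimum degree of a certificate is 1
  NEqualsOne : SimpleGraph n → Set
  NEqualsOne G = HasCertificateOfDegreeAtMost G 1 × ¬ HasCertificateOfDegreeAtMost G 0

  Condition2 : SimpleGraph n → Set
  Condition2 G =
    Σ (Fin n → Bool) λ a →
    Σ (Fin n → Fin n → Fin n → Bool) λ b →
      𝟙 ≈ ΣFin (λ i → scal (a i) (vertexPoly i))
          ⊕ ΣFin (λ i → ΣFin (λ j → ΣFin (λ k →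
               scal (isEdge< G i j ∧ b i j k) (X k ⊗ edgePoly i j))))

  Condition3 : SimpleGraph n → Set
  Condition3 G =
    Σ (Fin n → Fin n → Bool) λ a →
    Σ (Fin n → Fin n → Fin n → Bool) λ b →
      𝟙 ≈ ΣFin (λ i → ΣFin (λ j →
               scal (isEdge< G i j ∧ a i j) (X i ⊗ X i ⊗ X j ⊕ X i ⊗ X j ⊗ X j ⊕ 𝟙)))
          ⊕ ΣFin (λ i → ΣFin (λ j → ΣFin (λ k →
               scal (isEdge< G i j ∧ neq k i ∧ neq k j ∧ b i j k)
                    (X i ⊗ X i ⊗ X k ⊕ X i ⊗ X j ⊗ X k ⊕ X j ⊗ X j ⊗ X k))))

  Condition4 : SimpleGraph n → Set
  Condition4 G =
    Σ (Fin n → Fin n → Bool) λ a →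
    Σ (Fin n → Fin n → Fin n → Bool) λ b →
      𝟙 ≈ ΣFin (λ i → ΣFin (λ j →
               scal (isEdge< G i j ∧ a i j) (X i ⊗ X i ⊗ X j ⊕ X i ⊗ X j ⊗ X j ⊕ 𝟙)))
          ⊕ ΣFin (λ i → ΣFin (λ j → ΣFin (λ k →
               scal (adj G i j ∧ adj G j k ∧ b i j k)
                    (X i ⊗ X i ⊗ X k ⊕ X j ⊗ X j ⊗ X k ⊕ X i ⊗ X j ⊗ X j ⊕ X i ⊗ X k ⊗ X k))))

module Submission where

-- Every condition asserts that 1 lies in a GF(2)-linear span: of Bayer's polynomials times
-- monomials of degree ≤ d (a certificate of degree ≤ d), or of the polynomials listed in (2),
-- (3), (4). No certificate of degree 0 exists, because the parity of the coefficients in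
-- degrees 0 and 3 vanishes on x_i³ + 1 and on the quadratic edge polynomials but not on 1.
-- Projecting a certificate of degree 1 onto degrees 0 and 3 gives a combination as in (2),
-- and conversely. The generators of (3) lie in the span of those of (2) and the generators of
-- (4) in the span of those of (3). For (2) ⇒ (4), apply the linear map τ that fixes 1, sends
-- x_i³ to 1 and resolves each squarefree x_a x_b x_c along an edge among a, b, c; it maps
-- every generator of (2) into the span of (4).

open import Defs hiding (sym)

open import Algebra.Bundles using (CommutativeRing)
open import Data.Bool using (Bool; true; false; not; if_then_else_; _∧_; _xor_)
import Data.Bool.Properties as Bool
open import Data.Bool.Properties
  using ( xor-∧-commutativeRing; xor-assoc; xor-identityʳ; xor-same; not-involutive; not-injective
        ; ∧-distribˡ-xor; ∧-zeroʳ; ∧-identityʳ )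
open import Data.Empty using (⊥-elim)
open import Data.Fin using (Fin; zero; suc; toℕ; #_) renaming (_≤_ to _≤ᶠ_; _<_ to _<ᶠ_)
import Data.Fin.Properties as Fin
open import Data.List using (List; []; _∷_; _++_; map; concat; concatMap; allFin; foldr; filter)
import Data.List as List
import Data.List.Properties as List
open import Data.List.Membership.Propositional using (_∈_)
open import Data.List.Membership.Propositional.Properties using (∈-∃++)
open import Data.List.Relation.Unary.All using (All; []; _∷_)
import Data.List.Relation.Unary.All as All
import Data.List.Relation.Unary.All.Properties as All
open import Data.List.Relation.Unary.Any using (here; there)
open import Data.Nat using (ℕ; zero; suc; _+_; _≤_; s≤s; s≤s⁻¹; z≤n)
import Data.Nat.Properties as ℕ
open import Data.Product using (Σ; ∃; _×_; _,_)
open import Data.Sum using (_⊎_; inj₁; inj₂)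
open import Data.Vec using (Vec; []; _∷_; zipWith; replicate; tabulate; lookup)
open import Data.Vec.Properties using (≡-dec)
import Data.Vec.Properties as Vec
open import Function.Base using (_∘_; _⟨_⟩_)
open import Function.Bundles using (_⇔_; mk⇔; module Equivalence)
open import Function.Properties.Equivalence using () renaming (trans to ⇔-trans; sym to ⇔-sym)
open import Relation.Binary.Definitions using (tri<; tri≈; tri>)
open import Relation.Binary.PropositionalEquality
open import Relation.Nullary using (¬_; yes; no; does)
open import Relation.Nullary.Decidable using (⌊_⌋; True; toWitness; dec-true)
open import Relation.Unary using (Decidable)

open import Algebra.Properties.Semiring.Sum (CommutativeRing.semiring xor-∧-commutativeRing)
  using (sum; sum-cong-≗; ∑-distrib-+)
open import Algebra.Properties.CommutativeSemigroup
  (CommutativeRing.+-commutativeSemigroup xor-∧-commutativeRing)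
  using () renaming (interchange to xor-interchange)
open import Algebra.Properties.CommutativeSemigroup ℕ.+-commutativeSemigroup
  using () renaming (interchange to +-interchange)

δ : ∀ {k} → Fin k → Fin k → Bool
δ i j = ⌊ i Fin.≟ j ⌋

δ-refl : ∀ {k} (i : Fin k) → δ i i ≡ true
δ-refl i with i Fin.≟ i
... | yes _ = refl
... | no i≢i = ⊥-elim (i≢i refl)

δ-≢ : ∀ {k} {i j : Fin k} → i ≢ j → δ i j ≡ false
δ-≢ {i = i} {j} i≢j with i Fin.≟ j
... | yes i≡j = ⊥-elim (i≢j i≡j)
... | no _ = refl

δ-suc : ∀ {n} (i j : Fin n) → δ (suc i) (suc j) ≡ δ i j
δ-suc i j with i Fin.≟ j
... | yes _ = refl
... | no _ = refl

∧≡true : ∀ {a b} → a ∧ b ≡ true → a ≡ true × b ≡ true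
∧≡true {true} b≡true = refl , b≡true

xor-cancel : ∀ a b c → a xor (b xor (a xor c)) ≡ b xor c
xor-cancel false b c = refl
xor-cancel true false c = not-involutive c
xor-cancel true true c = not-involutive (not c)

xor-false⇒≡ : ∀ {a b} → a xor b ≡ false → a ≡ b
xor-false⇒≡ {false} {false} _ = refl
xor-false⇒≡ {true} {true} _ = refl

sum-zero : ∀ {k} (f : Fin k → Bool) → (∀ i → f i ≡ false) → sum f ≡ false
sum-zero {zero} f _ = refl
sum-zero {suc k} f z = cong₂ _xor_ (z zero) (sum-zero (λ i → f (suc i)) (λ i → z (suc i)))

sum-single : ∀ {k} (f : Fin k → Bool) i₀ → (∀ i → i ≢ i₀ → f i ≡ false) → sum f ≡ f i₀
sum-single {suc k} f zero z =
  trans (cong (f zero xor_) (sum-zero (λ i → f (suc i)) (λ i → z (suc i) λ ()))) (xor-identityʳ (f zero))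
sum-single {suc k} f (suc i₀) z =
  cong₂ _xor_ (z zero λ ())
              (sum-single (λ i → f (suc i)) i₀ λ i i≢i₀ → z (suc i) (i≢i₀ ∘ Fin.suc-injective))

sum-true : ∀ {k} (f : Fin k → Bool) → sum f ≡ true → ∃ λ i → f i ≡ true
sum-true {suc k} f eq with f zero in f₀
... | true = zero , f₀
... | false with sum-true (λ i → f (suc i)) eq
...   | i , fi = suc i , fi

module _ {n : ℕ} where

  same : Monomial n → Monomial n → Bool
  same m′ m = ⌊ ≡-dec ℕ._≟_ m′ m ⌋

  same-true : ∀ {m′ m} → same m′ m ≡ true → m′ ≡ m
  same-true {m′} {m} eq with ≡-dec ℕ._≟_ m′ m
  ... | yes m′≡m = m′≡m
  same-true () | no _

  same-refl : ∀ m → same m m ≡ true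
  same-refl m with ≡-dec ℕ._≟_ m m
  ... | yes _ = refl
  ... | no m≢m = ⊥-elim (m≢m refl)

  coeff-∷ : ∀ x (p : Poly n) m → coeff (x ∷ p) m ≡ same x m xor coeff p m
  coeff-∷ x p m with same x m
  ... | true = refl
  ... | false = refl

  coeff-⊕ : ∀ (p q : Poly n) m → coeff (p ⊕ q) m ≡ coeff p m xor coeff q m
  coeff-⊕ [] q m = refl
  coeff-⊕ (x ∷ p) q m = begin
    coeff (x ∷ p ⊕ q) m                     ≡⟨ coeff-∷ x (p ⊕ q) m ⟩
    same x m xor coeff (p ⊕ q) m            ≡⟨ cong (same x m xor_) (coeff-⊕ p q m) ⟩
    same x m xor (coeff p m xor coeff q m)  ≡⟨ xor-assoc (same x m) _ _ ⟨
    (same x m xor coeff p m) xor coeff q m  ≡⟨ cong (_xor coeff q m) (coeff-∷ x p m) ⟨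
    coeff (x ∷ p) m xor coeff q m           ∎
    where open ≡-Reasoning

  coeff-concat : ∀ {k} (f : Fin k → Poly n) m → coeff (concat (List.tabulate f)) m ≡ sum (λ i → coeff (f i) m)
  coeff-concat {zero} f m = refl
  coeff-concat {suc k} f m =
    trans (coeff-⊕ (f zero) _ m) (cong (coeff (f zero) m xor_) (coeff-concat (λ i → f (suc i)) m))

  coeff-ΣFin : ∀ (f : Fin n → Poly n) m → coeff (ΣFin f) m ≡ sum (λ i → coeff (f i) m)
  coeff-ΣFin f m = trans (cong (λ p → coeff (concat p) m) (List.map-tabulate (λ i → i) f)) (coeff-concat f m)

  infix 4 _≋_
  -- _≈_ wrapped in a record, so that the two polynomials can be inferred from a proof.
  record _≋_ (p q : Poly n) : Set where
    constructor coeffwise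
    field coeff-≡ : p ≈ q
  open _≋_ public

  ≋-refl : ∀ {p} → p ≋ p
  ≋-refl = coeffwise λ _ → refl

  ≋-sym : ∀ {p q} → p ≋ q → q ≋ p
  ≋-sym (coeffwise e) = coeffwise λ m → sym (e m)

  ≋-trans : ∀ {p q r} → p ≋ q → q ≋ r → p ≋ r
  ≋-trans (coeffwise e) (coeffwise f) = coeffwise λ m → trans (e m) (f m)

  ≡⇒≋ : ∀ {p q} → p ≡ q → p ≋ q
  ≡⇒≋ refl = ≋-refl

  ⊕-cong : ∀ {p p′ q q′} → p ≋ p′ → q ≋ q′ → p ⊕ q ≋ p′ ⊕ q′
  ⊕-cong {p} {p′} {q} {q′} (coeffwise e) (coeffwise f) = coeffwise λ m →
    trans (coeff-⊕ p q m) (trans (cong₂ _xor_ (e m) (f m)) (sym (coeff-⊕ p′ q′ m)))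

  ⊕-assoc : ∀ p q r → (p ⊕ q) ⊕ r ≋ p ⊕ (q ⊕ r)
  ⊕-assoc p q r = ≡⇒≋ (List.++-assoc p q r)

  ⊕-identityʳ : ∀ p → p ⊕ 𝟘 ≋ p
  ⊕-identityʳ p = ≡⇒≋ (List.++-identityʳ p)

  ⊕-self : ∀ p → p ⊕ p ≋ 𝟘
  ⊕-self p = coeffwise λ m → trans (coeff-⊕ p p m) (xor-same (coeff p m))

  ⊕-interchange : ∀ p q r s → (p ⊕ q) ⊕ (r ⊕ s) ≋ (p ⊕ r) ⊕ (q ⊕ s)
  ⊕-interchange p q r s = coeffwise λ m → begin
    coeff ((p ⊕ q) ⊕ (r ⊕ s)) m
      ≡⟨ trans (coeff-⊕ (p ⊕ q) _ m) (cong₂ _xor_ (coeff-⊕ p q m) (coeff-⊕ r s m)) ⟩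
    (coeff p m xor coeff q m) xor (coeff r m xor coeff s m)
      ≡⟨ xor-interchange (coeff p m) _ _ _ ⟩
    (coeff p m xor coeff r m) xor (coeff q m xor coeff s m)
      ≡⟨ sym (trans (coeff-⊕ (p ⊕ r) _ m) (cong₂ _xor_ (coeff-⊕ p r m) (coeff-⊕ q s m))) ⟩
    coeff ((p ⊕ r) ⊕ (q ⊕ s)) m ∎
    where open ≡-Reasoning

  scal-xor : ∀ a b p → scal (a xor b) p ≋ scal a p ⊕ scal b p
  scal-xor false b p = ≋-refl
  scal-xor true false p = ≋-sym (⊕-identityʳ p)
  scal-xor true true p = ≋-sym (⊕-self p)

  ΣFin-cong : ∀ {f g : Fin n → Poly n} → (∀ i → f i ≋ g i) → ΣFin f ≋ ΣFin g
  ΣFin-cong {f} {g} e = coeffwise λ m →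
    trans (coeff-ΣFin f m) (trans (sum-cong-≗ (λ i → coeff-≡ (e i) m)) (sym (coeff-ΣFin g m)))

  ΣFin-⊕ : ∀ (f g : Fin n → Poly n) → ΣFin (λ i → f i ⊕ g i) ≋ ΣFin f ⊕ ΣFin g
  ΣFin-⊕ f g = coeffwise λ m → begin
    coeff (ΣFin (λ i → f i ⊕ g i)) m
      ≡⟨ coeff-ΣFin _ m ⟩
    sum (λ i → coeff (f i ⊕ g i) m)
      ≡⟨ sum-cong-≗ (λ i → coeff-⊕ (f i) (g i) m) ⟩
    sum (λ i → coeff (f i) m xor coeff (g i) m)
      ≡⟨ ∑-distrib-+ (λ i → coeff (f i) m) _ ⟩
    sum (λ i → coeff (f i) m) xor sum (λ i → coeff (g i) m)
      ≡⟨ cong₂ _xor_ (coeff-ΣFin f m) (coeff-ΣFin g m) ⟨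
    coeff (ΣFin f) m xor coeff (ΣFin g) m
      ≡⟨ coeff-⊕ (ΣFin f) _ m ⟨
    coeff (ΣFin f ⊕ ΣFin g) m ∎
    where open ≡-Reasoning

  ΣFin-𝟘 : ∀ (f : Fin n → Poly n) → (∀ i → f i ≋ 𝟘) → ΣFin f ≋ 𝟘
  ΣFin-𝟘 f z = coeffwise λ m → trans (coeff-ΣFin f m) (sum-zero _ λ i → coeff-≡ (z i) m)

  ΣFin-single : ∀ (f : Fin n → Poly n) i₀ → (∀ i → i ≢ i₀ → f i ≋ 𝟘) → ΣFin f ≋ f i₀
  ΣFin-single f i₀ z = coeffwise λ m →
    trans (coeff-ΣFin f m) (sum-single _ i₀ λ i i≢i₀ → coeff-≡ (z i i≢i₀) m)

  linearForm : (Monomial n → Bool) → Poly n → Bool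
  linearForm g = foldr (λ m b → g m xor b) false

  linearForm-⊕ : ∀ g p q → linearForm g (p ⊕ q) ≡ linearForm g p xor linearForm g q
  linearForm-⊕ g [] q = refl
  linearForm-⊕ g (x ∷ p) q =
    trans (cong (g x xor_) (linearForm-⊕ g p q)) (sym (xor-assoc (g x) _ _))

  coeff-true⇒∈ : ∀ p m → coeff p m ≡ true → m ∈ p
  coeff-true⇒∈ (x ∷ p) m eq with same x m in x≡m
  ... | true = here (sym (same-true x≡m))
  ... | false = there (coeff-true⇒∈ p m eq)

  coeff-linearForm : ∀ p m → coeff p m ≡ linearForm (λ x → same x m) p
  coeff-linearForm [] m = refl
  coeff-linearForm (x ∷ p) m = trans (coeff-∷ x p m) (cong (same x m xor_) (coeff-linearForm p m))

  linearForm-pair : ∀ g y ys zs → linearForm g (y ∷ ys ++ y ∷ zs) ≡ linearForm g (ys ++ zs)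
  linearForm-pair g y ys zs = begin
    g y xor linearForm g (ys ++ y ∷ zs)                      ≡⟨ cong (g y xor_) (linearForm-⊕ g ys (y ∷ zs)) ⟩
    g y xor (linearForm g ys xor (g y xor linearForm g zs))  ≡⟨ xor-cancel (g y) (linearForm g ys) _ ⟩
    linearForm g ys xor linearForm g zs                      ≡⟨ linearForm-⊕ g ys zs ⟨
    linearForm g (ys ++ zs)                                  ∎
    where open ≡-Reasoning

  coeff-∷-self : ∀ q y → coeff (y ∷ q) y ≡ not (coeff q y)
  coeff-∷-self q y = trans (coeff-∷ y q y) (cong (_xor coeff q y) (same-refl y))

  -- Induction on the length: a vanishing list contains some monomial twice, and that pair cancels.
  linearForm-≋𝟘 : ∀ g k p → List.length p ≤ k → p ≋ 𝟘 → linearForm g p ≡ false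
  linearForm-≋𝟘 g k [] _ _ = refl
  linearForm-≋𝟘 g (suc k) (y ∷ q) (s≤s |q|≤k) (coeffwise p≈𝟘)
    with ∈-∃++ (coeff-true⇒∈ q y (not-injective (trans (sym (coeff-∷-self q y)) (p≈𝟘 y))))
  ... | ys , zs , refl = trans (linearForm-pair g y ys zs)
          (linearForm-≋𝟘 g k (ys ++ zs) (ℕ.≤-trans (shorter ys zs) |q|≤k) (coeffwise λ m →
            trans (coeff-linearForm (ys ++ zs) m)
           (trans (sym (linearForm-pair (λ x → same x m) y ys zs))
           (trans (sym (coeff-linearForm (y ∷ ys ++ y ∷ zs) m)) (p≈𝟘 m)))))
    where
    shorter : ∀ (ys zs : Poly n) → List.length (ys ++ zs) ≤ List.length (ys ++ y ∷ zs)
    shorter ys zs rewrite List.length-++ ys {zs} | List.length-++ ys {y ∷ zs} =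
      ℕ.+-monoʳ-≤ (List.length ys) (ℕ.n≤1+n _)

  linearForm-resp : ∀ g {p q} → p ≋ q → linearForm g p ≡ linearForm g q
  linearForm-resp g {p} {q} (coeffwise p≈q) = xor-false⇒≡ (trans (sym (linearForm-⊕ g p q))
    (linearForm-≋𝟘 g _ (p ⊕ q) ℕ.≤-refl (coeffwise λ m →
      trans (coeff-⊕ p q m) (trans (cong (coeff p m xor_) (sym (p≈q m))) (xor-same (coeff p m))))))

  linearMap : (Monomial n → Poly n) → Poly n → Poly n
  linearMap = concatMap

  coeff-linearMap : ∀ F p m → coeff (linearMap F p) m ≡ linearForm (λ x → coeff (F x) m) p
  coeff-linearMap F [] m = refl
  coeff-linearMap F (x ∷ p) m =
    trans (coeff-⊕ (F x) _ m) (cong (coeff (F x) m xor_) (coeff-linearMap F p m))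

  linearMap-resp : ∀ F {p q} → p ≋ q → linearMap F p ≋ linearMap F q
  linearMap-resp F {p} {q} p≋q = coeffwise λ m → trans (coeff-linearMap F p m)
    (trans (linearForm-resp (λ x → coeff (F x) m) p≋q) (sym (coeff-linearMap F q m)))

  linearMap-concat : ∀ F (ps : List (Poly n)) → linearMap F (concat ps) ≡ concat (map (linearMap F) ps)
  linearMap-concat F [] = refl
  linearMap-concat F (p ∷ ps) =
    trans (List.concatMap-++ F p (concat ps)) (cong (linearMap F p ++_) (linearMap-concat F ps))

  linearMap-ΣFin : ∀ F (f : Fin n → Poly n) → linearMap F (ΣFin f) ≡ ΣFin (λ i → linearMap F (f i))
  linearMap-ΣFin F f = trans (linearMap-concat F (map f (allFin n))) (cong concat (sym (List.map-∘ (allFin n))))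

  linearMap-scal : ∀ F c (p : Poly n) → linearMap F (scal c p) ≡ scal c (linearMap F p)
  linearMap-scal F true p = refl
  linearMap-scal F false p = refl

  data Span (S : Poly n → Set) : Poly n → Set where
    span-𝟘 : Span S 𝟘
    span-gen-⊕ : ∀ {g p} → S g → Span S p → Span S (g ⊕ p)
    span-≋ : ∀ {p q} → p ≋ q → Span S p → Span S q

  module _ {S : Poly n → Set} where

    span-⊕ : ∀ {p q} → Span S p → Span S q → Span S (p ⊕ q)
    span-⊕ span-𝟘 sq = sq
    span-⊕ {q = q} (span-gen-⊕ {g} {p} sg sp) sq =
      span-≋ (≋-sym (⊕-assoc g p q)) (span-gen-⊕ sg (span-⊕ sp sq))
    span-⊕ (span-≋ p≋p′ sp) sq = span-≋ (⊕-cong p≋p′ ≋-refl) (span-⊕ sp sq)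

    span-gen : ∀ {g p} → S g → g ≋ p → Span S p
    span-gen {g} sg g≋p = span-≋ (≋-trans (⊕-identityʳ g) g≋p) (span-gen-⊕ sg span-𝟘)

    span-≋𝟘 : ∀ {p} → p ≋ 𝟘 → Span S p
    span-≋𝟘 p≋𝟘 = span-≋ (≋-sym p≋𝟘) span-𝟘

    span-concat : ∀ {k} (f : Fin k → Poly n) → (∀ i → Span S (f i)) → Span S (concat (List.tabulate f))
    span-concat {zero} f sf = span-𝟘
    span-concat {suc k} f sf = span-⊕ (sf zero) (span-concat (λ i → f (suc i)) (λ i → sf (suc i)))

    span-ΣFin : ∀ (f : Fin n → Poly n) → (∀ i → Span S (f i)) → Span S (ΣFin f)
    span-ΣFin f sf = subst (Span S) (cong concat (sym (List.map-tabulate (λ i → i) f))) (span-concat f sf)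

    span-linearMap-All : ∀ {S′ : Monomial n → Set} F → (∀ {x} → S′ x → Span S (F x)) →
                         ∀ {p} → All S′ p → Span S (linearMap F p)
    span-linearMap-All F sF [] = span-𝟘
    span-linearMap-All F sF (s′x ∷ s′p) = span-⊕ (sF s′x) (span-linearMap-All F sF s′p)

  span-mono : ∀ {S S′} → (∀ {g} → S g → Span S′ g) → ∀ {p} → Span S p → Span S′ p
  span-mono S⊆S′ span-𝟘 = span-𝟘
  span-mono S⊆S′ (span-gen-⊕ sg sp) = span-⊕ (S⊆S′ sg) (span-mono S⊆S′ sp)
  span-mono S⊆S′ (span-≋ p≋q sp) = span-≋ p≋q (span-mono S⊆S′ sp)

  span-linearMap : ∀ {S S′} F → (∀ {g} → S g → Span S′ (linearMap F g)) →
                   ∀ {p} → Span S p → Span S′ (linearMap F p)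
  span-linearMap F sF span-𝟘 = span-𝟘
  span-linearMap F sF (span-gen-⊕ {g} {p} sg sp) =
    subst (Span _) (sym (List.concatMap-++ F g p)) (span-⊕ (sF sg) (span-linearMap F sF sp))
  span-linearMap F sF (span-≋ p≋q sp) = span-≋ (linearMap-resp F p≋q) (span-linearMap F sF sp)

  linearForm-span : ∀ {S} φ → (∀ {g} → S g → linearForm φ g ≡ false) →
                    ∀ {p} → Span S p → linearForm φ p ≡ false
  linearForm-span φ φS span-𝟘 = refl
  linearForm-span φ φS (span-gen-⊕ {g} {p} sg sp) =
    trans (linearForm-⊕ φ g p) (cong₂ _xor_ (φS sg) (linearForm-span φ φS sp))
  linearForm-span φ φS (span-≋ p≋q sp) = trans (sym (linearForm-resp φ p≋q)) (linearForm-span φ φS sp)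

  record LinearFamily : Set₁ where
    field
      Coeff : Set
      0ᶜ : Coeff
      _+ᶜ_ : Coeff → Coeff → Coeff
      ⟦_⟧ : Coeff → Poly n
      ⟦0ᶜ⟧ : ⟦ 0ᶜ ⟧ ≋ 𝟘
      ⟦+ᶜ⟧ : ∀ a b → ⟦ a +ᶜ b ⟧ ≋ ⟦ a ⟧ ⊕ ⟦ b ⟧

    Image : Poly n → Set
    Image p = Σ Coeff λ c → p ≋ ⟦ c ⟧

    SpannedBy : (Poly n → Set) → Set
    SpannedBy S = ∀ c → Span S ⟦ c ⟧

    span⊆Image : ∀ {S} → (∀ {g} → S g → Image g) → ∀ {p} → Span S p → Image p
    span⊆Image S⊆I span-𝟘 = 0ᶜ , ≋-sym ⟦0ᶜ⟧
    span⊆Image S⊆I (span-gen-⊕ sg sp) with S⊆I sg | span⊆Image S⊆I sp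
    ... | a , g≋ | b , p≋ = a +ᶜ b , ≋-trans (⊕-cong g≋ p≋) (≋-sym (⟦+ᶜ⟧ a b))
    span⊆Image S⊆I (span-≋ p≋q sp) with span⊆Image S⊆I sp
    ... | c , p≋ = c , ≋-trans (≋-sym p≋q) p≋

  open LinearFamily public

  guard : List Bool → Bool → Bool
  guard gs a = foldr _∧_ a gs

  guard-false : ∀ gs → guard gs false ≡ false
  guard-false [] = refl
  guard-false (g ∷ gs) = trans (cong (g ∧_) (guard-false gs)) (∧-zeroʳ g)

  guard-xor : ∀ gs a b → guard gs (a xor b) ≡ guard gs a xor guard gs b
  guard-xor [] a b = refl
  guard-xor (g ∷ gs) a b = trans (cong (g ∧_) (guard-xor gs a b)) (∧-distribˡ-xor g _ _)

  guard-true : ∀ {gs} → All (_≡ true) gs → guard gs true ≡ true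
  guard-true [] = refl
  guard-true (refl ∷ gs) = guard-true gs

  guard-holds : ∀ gs a → guard gs a ≡ true → All (_≡ true) gs
  guard-holds [] a _ = []
  guard-holds (true ∷ gs) a eq = refl ∷ guard-holds gs a eq

  -- The multiples a · P of one generator, switched off unless its side conditions gs all hold.
  -- Keeping gs as a list makes the coefficient guard gs a unfold to the conjunctions of Condition2–4.
  guardedTerm : List Bool → Poly n → LinearFamily
  guardedTerm gs P = record
    { Coeff = Bool ; 0ᶜ = false ; _+ᶜ_ = _xor_
    ; ⟦_⟧ = λ a → scal (guard gs a) P
    ; ⟦0ᶜ⟧ = ≡⇒≋ (cong (λ c → scal c P) (guard-false gs))
    ; ⟦+ᶜ⟧ = λ a b →
        ≋-trans (≡⇒≋ (cong (λ c → scal c P) (guard-xor gs a b))) (scal-xor (guard gs a) _ P)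
    }

  guardedTerm-image : ∀ {gs} P → All (_≡ true) gs → Image (guardedTerm gs P) P
  guardedTerm-image P gs-hold = true , ≡⇒≋ (cong (λ c → scal c P) (sym (guard-true gs-hold)))

  guardedTerm-spanned : ∀ {S} gs P → (All (_≡ true) gs → S P) → SpannedBy (guardedTerm gs P) S
  guardedTerm-spanned gs P SP a with guard gs a in eq
  ... | false = span-𝟘
  ... | true = span-gen (SP (guard-holds gs a eq)) ≋-refl

  ΣFinᴸ : (Fin n → LinearFamily) → LinearFamily
  ΣFinᴸ L = record
    { Coeff = ∀ i → Coeff (L i) ; 0ᶜ = λ i → 0ᶜ (L i) ; _+ᶜ_ = λ a b i → _+ᶜ_ (L i) (a i) (b i)
    ; ⟦_⟧ = λ c → ΣFin (λ i → ⟦ L i ⟧ (c i))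
    ; ⟦0ᶜ⟧ = ΣFin-𝟘 _ λ i → ⟦0ᶜ⟧ (L i)
    ; ⟦+ᶜ⟧ = λ a b → ≋-trans (ΣFin-cong λ i → ⟦+ᶜ⟧ (L i) (a i) (b i)) (ΣFin-⊕ _ _)
    }

  ΣFinᴸ-image : ∀ L i₀ {p} → Image (L i₀) p → Image (ΣFinᴸ L) p
  ΣFinᴸ-image L i₀ (c₀ , p≋) = c , ≋-trans p≋ (≋-sym (≋-trans (ΣFin-single _ i₀ elsewhere-𝟘) at-i₀))
    where
    c : ∀ i → Coeff (L i)
    c i with i Fin.≟ i₀
    ... | yes refl = c₀
    ... | no _ = 0ᶜ (L i)
    elsewhere-𝟘 : ∀ i → i ≢ i₀ → ⟦ L i ⟧ (c i) ≋ 𝟘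
    elsewhere-𝟘 i i≢i₀ with i Fin.≟ i₀
    ... | yes i≡i₀ = ⊥-elim (i≢i₀ i≡i₀)
    ... | no _ = ⟦0ᶜ⟧ (L i)
    at-i₀ : ⟦ L i₀ ⟧ (c i₀) ≋ ⟦ L i₀ ⟧ c₀
    at-i₀ with i₀ Fin.≟ i₀
    ... | yes refl = ≋-refl
    ... | no i₀≢i₀ = ⊥-elim (i₀≢i₀ refl)

  ΣFinᴸ-spanned : ∀ {S} L → (∀ i → SpannedBy (L i) S) → SpannedBy (ΣFinᴸ L) S
  ΣFinᴸ-spanned L spanned c = span-ΣFin _ λ i → spanned i (c i)

  infixl 6 _⊕ᴸ_
  _⊕ᴸ_ : LinearFamily → LinearFamily → LinearFamily
  L ⊕ᴸ M = record
    { Coeff = Coeff L × Coeff M ; 0ᶜ = 0ᶜ L , 0ᶜ M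
    ; _+ᶜ_ = λ (a , b) (a′ , b′) → _+ᶜ_ L a a′ , _+ᶜ_ M b b′
    ; ⟦_⟧ = λ (a , b) → ⟦ L ⟧ a ⊕ ⟦ M ⟧ b
    ; ⟦0ᶜ⟧ = ≋-trans (⊕-cong (⟦0ᶜ⟧ L) (⟦0ᶜ⟧ M)) ≋-refl
    ; ⟦+ᶜ⟧ = λ (a , b) (a′ , b′) →
        ≋-trans (⊕-cong (⟦+ᶜ⟧ L a a′) (⟦+ᶜ⟧ M b b′))
                (⊕-interchange (⟦ L ⟧ a) (⟦ L ⟧ a′) (⟦ M ⟧ b) (⟦ M ⟧ b′))
    }

  ⊕ᴸ-imageˡ : ∀ L M {p} → Image L p → Image (L ⊕ᴸ M) p
  ⊕ᴸ-imageˡ L M (a , p≋) =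
    (a , 0ᶜ M) , ≋-trans p≋ (≋-trans (≋-sym (⊕-identityʳ _)) (⊕-cong ≋-refl (≋-sym (⟦0ᶜ⟧ M))))

  ⊕ᴸ-imageʳ : ∀ L M {p} → Image M p → Image (L ⊕ᴸ M) p
  ⊕ᴸ-imageʳ L M (b , p≋) = (0ᶜ L , b) , ≋-trans p≋ (≋-sym (⊕-cong (⟦0ᶜ⟧ L) ≋-refl))

  ⊕ᴸ-spanned : ∀ {S} L M → SpannedBy L S → SpannedBy M S → SpannedBy (L ⊕ᴸ M) S
  ⊕ᴸ-spanned L M sL sM (a , b) = span-⊕ (sL a) (sM b)

  image⇔span : ∀ (L : LinearFamily) {S} → SpannedBy L S → (∀ {g} → S g → Image L g) →
               ∀ {p} → Image L p ⇔ Span S p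
  image⇔span L spanned S⊆I = mk⇔ (λ (c , p≋) → span-≋ (≋-sym p≋) (spanned c)) (span⊆Image L S⊆I)

  combination⇔image : ∀ (L M : LinearFamily) {p} →
    (Σ (Coeff L) λ a → Σ (Coeff M) λ b → p ≈ ⟦ L ⟧ a ⊕ ⟦ M ⟧ b) ⇔ Image (L ⊕ᴸ M) p
  combination⇔image L M =
    mk⇔ (λ (a , b , e) → (a , b) , coeffwise e) (λ ((a , b) , coeffwise e) → a , b , e)

  guarded₁ : (Fin n → List Bool) → (Fin n → Poly n) → LinearFamily
  guarded₁ gs P = ΣFinᴸ λ i → guardedTerm (gs i) (P i)

  guarded₂ : (Fin n → Fin n → List Bool) → (Fin n → Fin n → Poly n) → LinearFamily
  guarded₂ gs P = ΣFinᴸ λ i → guarded₁ (gs i) (P i)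

  guarded₃ : (Fin n → Fin n → Fin n → List Bool) → (Fin n → Fin n → Fin n → Poly n) → LinearFamily
  guarded₃ gs P = ΣFinᴸ λ i → guarded₂ (gs i) (P i)

  guarded₁-image : ∀ gs P {i} → All (_≡ true) (gs i) → Image (guarded₁ gs P) (P i)
  guarded₁-image gs P {i} hold = ΣFinᴸ-image (λ i → guardedTerm (gs i) (P i)) i (guardedTerm-image (P i) hold)

  guarded₂-image : ∀ gs P {i j} → All (_≡ true) (gs i j) → Image (guarded₂ gs P) (P i j)
  guarded₂-image gs P {i} hold =
    ΣFinᴸ-image (λ i → guarded₁ (gs i) (P i)) i (guarded₁-image (gs i) (P i) hold)

  guarded₃-image : ∀ gs P {i j k} → All (_≡ true) (gs i j k) → Image (guarded₃ gs P) (P i j k)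
  guarded₃-image gs P {i} hold =
    ΣFinᴸ-image (λ i → guarded₂ (gs i) (P i)) i (guarded₂-image (gs i) (P i) hold)

  module _ {S : Poly n → Set} where

    guarded₁-spanned : ∀ gs P → (∀ i → All (_≡ true) (gs i) → S (P i)) → SpannedBy (guarded₁ gs P) S
    guarded₁-spanned gs P SP =
      ΣFinᴸ-spanned (λ i → guardedTerm (gs i) (P i)) λ i → guardedTerm-spanned (gs i) (P i) (SP i)

    guarded₂-spanned : ∀ gs P → (∀ i j → All (_≡ true) (gs i j) → S (P i j)) → SpannedBy (guarded₂ gs P) S
    guarded₂-spanned gs P SP =
      ΣFinᴸ-spanned (λ i → guarded₁ (gs i) (P i)) λ i → guarded₁-spanned (gs i) (P i) (SP i)

    guarded₃-spanned : ∀ gs P → (∀ i j k → All (_≡ true) (gs i j k) → S (P i j k)) →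
                       SpannedBy (guarded₃ gs P) S
    guarded₃-spanned gs P SP =
      ΣFinᴸ-spanned (λ i → guarded₂ (gs i) (P i)) λ i → guarded₂-spanned (gs i) (P i) (SP i)

infixl 6 _·_
_·_ : ∀ {n} → Monomial n → Monomial n → Monomial n
_·_ = zipWith _+_

one : ∀ n → Monomial n
one n = replicate n 0

-- Chosen so that X i is unit i ∷ [] and X a ⊗ X b ⊗ X c reduces to cubic a b c ∷ [].
unit : ∀ {n} → Fin n → Monomial n
unit i = tabulate (λ j → if ⌊ i Fin.≟ j ⌋ then 1 else 0)

quadratic : ∀ {n} → Fin n → Fin n → Monomial n
quadratic a b = unit a · unit b

cubic : ∀ {n} → Fin n → Fin n → Fin n → Monomial n
cubic a b c = unit a · unit b · unit c

module _ {n : ℕ} where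

  ·-comm : ∀ (x y : Monomial n) → x · y ≡ y · x
  ·-comm = Vec.zipWith-comm ℕ.+-comm

  ·-assoc : ∀ (x y z : Monomial n) → x · y · z ≡ x · (y · z)
  ·-assoc = Vec.zipWith-assoc ℕ.+-assoc

  one-· : ∀ (x : Monomial n) → one n · x ≡ x
  one-· = Vec.zipWith-identityˡ ℕ.+-identityˡ

  ·-identityʳ : ∀ (x : Monomial n) → x · one n ≡ x
  ·-identityʳ = Vec.zipWith-identityʳ ℕ.+-identityʳ

  unit-·-quadratic : ∀ (k a b : Fin n) → unit k · quadratic a b ≡ cubic k a b
  unit-·-quadratic k a b = sym (·-assoc (unit k) (unit a) (unit b))

  cubic-swap₁₂ : ∀ (a b c : Fin n) → cubic a b c ≡ cubic b a c
  cubic-swap₁₂ a b c = cong (_· unit c) (·-comm (unit a) (unit b))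

  cubic-swap₂₃ : ∀ (a b c : Fin n) → cubic a b c ≡ cubic a c b
  cubic-swap₂₃ a b c = begin
    unit a · unit b · unit c    ≡⟨ ·-assoc (unit a) (unit b) (unit c) ⟩
    unit a · (unit b · unit c)  ≡⟨ cong (unit a ·_) (·-comm (unit b) (unit c)) ⟩
    unit a · (unit c · unit b)  ≡⟨ ·-assoc (unit a) (unit c) (unit b) ⟨
    unit a · unit c · unit b    ∎
    where open ≡-Reasoning

  cubic-rotate : ∀ (a b c : Fin n) → cubic a b c ≡ cubic b c a
  cubic-rotate a b c = trans (cubic-swap₁₂ a b c) (cubic-swap₂₃ b a c)

tabulate-const : ∀ n (x : ℕ) → tabulate {n = n} (λ _ → x) ≡ replicate n x
tabulate-const zero x = refl
tabulate-const (suc n) x = cong (x ∷_) (tabulate-const n x)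

unit-zero : ∀ {n} → unit {suc n} zero ≡ 1 ∷ one n
unit-zero {n} = cong (1 ∷_) (tabulate-const n 0)

unit-suc : ∀ {n} (i : Fin n) → unit (suc i) ≡ 0 ∷ unit i
unit-suc i = cong (0 ∷_) (Vec.tabulate-cong λ j → cong (λ b → if b then 1 else 0) (δ-suc i j))

support : ∀ {n} → Monomial n → List (Fin n)
support [] = []
support (e ∷ m) = List.replicate e zero ++ map suc (support m)

support-one : ∀ n → support (one n) ≡ []
support-one zero = refl
support-one (suc n) = cong (map suc) (support-one n)

support-unit-· : ∀ {n} (a : Fin n) (m : Monomial n) → All (a ≤ᶠ_) (support m) →
                 support (unit a · m) ≡ a ∷ support m
support-unit-· zero (e ∷ m) _ =
  trans (cong (λ u → support (u · (e ∷ m))) unit-zero) (cong (λ m′ → support (suc e ∷ m′)) (one-· m))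
support-unit-· (suc a) (suc e ∷ m) (() ∷ _)
support-unit-· (suc a) (zero ∷ m) a≤m = begin
  support (unit (suc a) · (0 ∷ m))   ≡⟨ cong (λ u → support (u · (0 ∷ m))) (unit-suc a) ⟩
  map suc (support (unit a · m))     ≡⟨ cong (map suc) (support-unit-· a m (All.map s≤s⁻¹ (All.map⁻ a≤m))) ⟩
  suc a ∷ map suc (support m)        ∎
  where open ≡-Reasoning

support-unit : ∀ {n} (a : Fin n) → support (unit a) ≡ a ∷ []
support-unit {n} a = begin
  support (unit a)            ≡⟨ cong support (sym (·-identityʳ (unit a))) ⟩
  support (unit a · one n)    ≡⟨ support-unit-· a (one n) (subst (All _) (sym (support-one n)) []) ⟩
  a ∷ support (one n)         ≡⟨ cong (a ∷_) (support-one n) ⟩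
  a ∷ []                      ∎
  where open ≡-Reasoning

support-cubic : ∀ {n} {a b c : Fin n} → a ≤ᶠ b → b ≤ᶠ c → support (cubic a b c) ≡ a ∷ b ∷ c ∷ []
support-cubic {a = a} {b} {c} a≤b b≤c = begin
  support (cubic a b c)                 ≡⟨ cong support (·-assoc (unit a) (unit b) (unit c)) ⟩
  support (unit a · (unit b · unit c))  ≡⟨ support-unit-· a _ (subst (All _) (sym bc) a≤bc) ⟩
  a ∷ support (unit b · unit c)         ≡⟨ cong (a ∷_) bc ⟩
  a ∷ b ∷ c ∷ []                        ∎
  where
  open ≡-Reasoning
  bc : support (unit b · unit c) ≡ b ∷ c ∷ []
  bc = trans (support-unit-· b (unit c) (subst (All _) (sym (support-unit c)) (b≤c ∷ [])))
             (cong (b ∷_) (support-unit c))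
  a≤bc : All (a ≤ᶠ_) (b ∷ c ∷ [])
  a≤bc = a≤b ∷ ℕ.≤-trans a≤b b≤c ∷ []

totalDegree-· : ∀ {n} (x y : Monomial n) → totalDegree (x · y) ≡ totalDegree x + totalDegree y
totalDegree-· [] [] = refl
totalDegree-· (a ∷ x) (b ∷ y) =
  trans (cong (a + b +_) (totalDegree-· x y)) (+-interchange a b (totalDegree x) (totalDegree y))

totalDegree-one : ∀ n → totalDegree (one n) ≡ 0
totalDegree-one zero = refl
totalDegree-one (suc n) = totalDegree-one n

totalDegree-unit : ∀ {n} (a : Fin n) → totalDegree (unit a) ≡ 1
totalDegree-unit {suc n} zero = trans (cong totalDegree (unit-zero {n})) (cong suc (totalDegree-one n))
totalDegree-unit {suc n} (suc a) = trans (cong totalDegree (unit-suc a)) (totalDegree-unit a)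

totalDegree-unit-· : ∀ {n} (a : Fin n) (x : Monomial n) → totalDegree (unit a · x) ≡ suc (totalDegree x)
totalDegree-unit-· a x = trans (totalDegree-· (unit a) x) (cong (_+ totalDegree x) (totalDegree-unit a))

totalDegree-quadratic : ∀ {n} (a b : Fin n) → totalDegree (quadratic a b) ≡ 2
totalDegree-quadratic a b = trans (totalDegree-unit-· a (unit b)) (cong suc (totalDegree-unit b))

totalDegree-cubic : ∀ {n} (a b c : Fin n) → totalDegree (cubic a b c) ≡ 3
totalDegree-cubic a b c = begin
  totalDegree (cubic a b c)                      ≡⟨ cong totalDegree (·-assoc (unit a) (unit b) (unit c)) ⟩
  totalDegree (unit a · quadratic b c)           ≡⟨ totalDegree-unit-· a (quadratic b c) ⟩
  suc (totalDegree (quadratic b c))              ≡⟨ cong suc (totalDegree-quadratic b c) ⟩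
  3                                              ∎
  where open ≡-Reasoning

totalDegree≡0 : ∀ {n} (x : Monomial n) → totalDegree x ≡ 0 → x ≡ one n
totalDegree≡0 [] _ = refl
totalDegree≡0 (zero ∷ x) deg≡0 = cong (0 ∷_) (totalDegree≡0 x deg≡0)

totalDegree≤1 : ∀ {n} (x : Monomial n) → totalDegree x ≤ 1 → x ≡ one n ⊎ ∃ λ k → x ≡ unit k
totalDegree≤1 [] _ = inj₁ refl
totalDegree≤1 (zero ∷ x) deg≤1 with totalDegree≤1 x deg≤1
... | inj₁ x≡one = inj₁ (cong (0 ∷_) x≡one)
... | inj₂ (k , x≡unit) = inj₂ (suc k , trans (cong (0 ∷_) x≡unit) (sym (unit-suc k)))
totalDegree≤1 (suc zero ∷ x) (s≤s deg≤0) =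
  inj₂ (zero , trans (cong (1 ∷_) (totalDegree≡0 x (ℕ.n≤0⇒n≡0 deg≤0))) (sym unit-zero))

module _ {n k : ℕ} (atoms : Vec (Monomial n) k) where

  parity : List (Fin k) → Fin k → Bool
  parity [] x = false
  parity (y ∷ l) x = δ x y xor parity l x

  coeff-atoms : ∀ l m → coeff (map (lookup atoms) l) m ≡ sum (λ x → same (lookup atoms x) m ∧ parity l x)
  coeff-atoms [] m = sym (sum-zero (λ x → same (lookup atoms x) m ∧ false) λ x → ∧-zeroʳ _)
  coeff-atoms (y ∷ l) m = begin
    coeff (lookup atoms y ∷ map (lookup atoms) l) m
      ≡⟨ coeff-∷ (lookup atoms y) (map (lookup atoms) l) m ⟩
    same (lookup atoms y) m xor coeff (map (lookup atoms) l) m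
      ≡⟨ cong₂ _xor_ (sym (trans (sum-single _ y at-y) (trans (cong (s y ∧_) (δ-refl y)) (∧-identityʳ (s y)))))
                     (coeff-atoms l m) ⟩
    sum (λ x → s x ∧ δ x y) xor sum (λ x → s x ∧ parity l x)
      ≡⟨ ∑-distrib-+ (λ x → s x ∧ δ x y) _ ⟨
    sum (λ x → (s x ∧ δ x y) xor (s x ∧ parity l x))
      ≡⟨ sum-cong-≗ (λ x → sym (∧-distribˡ-xor (s x) (δ x y) _)) ⟩
    sum (λ x → s x ∧ parity (y ∷ l) x) ∎
    where
    open ≡-Reasoning
    s : Fin k → Bool
    s x = same (lookup atoms x) m
    at-y : ∀ x → x ≢ y → s x ∧ δ x y ≡ false
    at-y x x≢y = trans (cong (s x ∧_) (δ-≢ x≢y)) (∧-zeroʳ (s x))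

  -- Sound even when some atoms coincide: equal parities of all indices force equal coefficients.
  ≋-byParity : ∀ l₁ l₂ → {True (Fin.all? λ x → parity l₁ x Bool.≟ parity l₂ x)} →
               map (lookup atoms) l₁ ≋ map (lookup atoms) l₂
  ≋-byParity l₁ l₂ {same-parity} = coeffwise λ m →
    trans (coeff-atoms l₁ m)
          (trans (sum-cong-≗ λ x → cong (same (lookup atoms x) m ∧_) (toWitness same-parity x))
                 (sym (coeff-atoms l₂ m)))

module _ {n : ℕ} where

  edgeCubic : Fin n → Fin n → Poly n
  edgeCubic i j = X i ⊗ X i ⊗ X j ⊕ X i ⊗ X j ⊗ X j ⊕ 𝟙

  edgeTriple : Fin n → Fin n → Fin n → Poly n
  edgeTriple i j k = X i ⊗ X i ⊗ X k ⊕ X i ⊗ X j ⊗ X k ⊕ X j ⊗ X j ⊗ X k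

  pathPoly : Fin n → Fin n → Fin n → Poly n
  pathPoly i j k = X i ⊗ X i ⊗ X k ⊕ X j ⊗ X j ⊗ X k ⊕ X i ⊗ X j ⊗ X j ⊕ X i ⊗ X k ⊗ X k

  edgeMultiple-cubics : ∀ (k i j : Fin n) → X k ⊗ edgePoly i j ≡ cubic k i i ∷ cubic k i j ∷ cubic k j j ∷ []
  edgeMultiple-cubics k i j =
    cong₂ _∷_ (unit-·-quadratic k i i)
              (cong₂ _∷_ (unit-·-quadratic k i j) (cong (_∷ []) (unit-·-quadratic k j j)))

  edgeMultiple≡edgeTriple : ∀ (k i j : Fin n) → X k ⊗ edgePoly i j ≡ edgeTriple i j k
  edgeMultiple≡edgeTriple k i j = trans (edgeMultiple-cubics k i j)
    (cong₂ _∷_ (cubic-rotate k i i) (cong₂ _∷_ (cubic-rotate k i j) (cong (_∷ []) (cubic-rotate k j j))))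

  edgeCubic-cubics : ∀ (i j : Fin n) → edgeCubic i j ≡ cubic i i j ∷ cubic j j i ∷ one n ∷ []
  edgeCubic-cubics i j = cong (λ m → cubic i i j ∷ m ∷ one n ∷ []) (cubic-rotate i j j)

  pathPoly-cubics : ∀ (i j k : Fin n) →
                    pathPoly i j k ≡ cubic i i k ∷ cubic j j k ∷ cubic j j i ∷ cubic k k i ∷ []
  pathPoly-cubics i j k =
    cong₂ (λ m m′ → cubic i i k ∷ cubic j j k ∷ m ∷ m′ ∷ []) (cubic-rotate i j j) (cubic-rotate i k k)

  edgeCubic≋ : ∀ (i j : Fin n) → vertexPoly i ⊕ X i ⊗ edgePoly i j ≋ edgeCubic i j
  edgeCubic≋ i j = ≋-trans (≡⇒≋ (cong (λ p → cubic i i i ∷ one n ∷ p) (edgeMultiple-cubics i i j)))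
    (≋-byParity (cubic i i i ∷ cubic i i j ∷ cubic i j j ∷ one n ∷ [])
                (# 0 ∷ # 3 ∷ # 0 ∷ # 1 ∷ # 2 ∷ []) (# 1 ∷ # 2 ∷ # 3 ∷ []))

  edgeTriple-swap : ∀ (a b c : Fin n) → edgeTriple a b c ≋ edgeTriple b a c
  edgeTriple-swap a b c = ≋-trans
    (≡⇒≋ (cong (λ m → cubic a a c ∷ m ∷ cubic b b c ∷ []) (cubic-swap₁₂ a b c)))
    (≋-byParity (cubic a a c ∷ cubic b a c ∷ cubic b b c ∷ []) (# 0 ∷ # 1 ∷ # 2 ∷ []) (# 2 ∷ # 1 ∷ # 0 ∷ []))

  pathPoly-loop≋𝟘 : ∀ (i j : Fin n) → pathPoly i j i ≋ 𝟘
  pathPoly-loop≋𝟘 i j = ≋-trans (≡⇒≋ (pathPoly-cubics i j i))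
    (≋-byParity (cubic i i i ∷ cubic j j i ∷ []) (# 0 ∷ # 1 ∷ # 1 ∷ # 0 ∷ []) [])

  pathPoly≋ : ∀ (i j k : Fin n) → pathPoly i j k ≋ edgeTriple i j k ⊕ edgeTriple j k i
  pathPoly≋ i j k = ≋-trans (≡⇒≋ (pathPoly-cubics i j k))
    (≋-trans (≋-byParity (cubic i i k ∷ cubic i j k ∷ cubic j j k ∷ cubic j j i ∷ cubic k k i ∷ [])
                         (# 0 ∷ # 2 ∷ # 3 ∷ # 4 ∷ []) (# 0 ∷ # 1 ∷ # 2 ∷ # 3 ∷ # 1 ∷ # 4 ∷ []))
             (≡⇒≋ (cong (λ m → cubic i i k ∷ cubic i j k ∷ cubic j j k ∷ cubic j j i ∷ m ∷ cubic k k i ∷ [])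
                        (cubic-rotate i j k))))

  pairs≋𝟘 : ∀ (i j k : Fin n) → cubic i i k ∷ cubic i i k ∷ cubic j j k ∷ cubic j j k ∷ [] ≋ 𝟘
  pairs≋𝟘 i j k = ≋-byParity (cubic i i k ∷ cubic j j k ∷ []) (# 0 ∷ # 0 ∷ # 1 ∷ # 1 ∷ []) []

-- The generating sets of (2), (3) and (4)

module Generators {n : ℕ} (G : SimpleGraph n) where

  data Gen₂ : Poly n → Set where
    vertex : ∀ i → Gen₂ (vertexPoly i)
    edge : ∀ {i j} k → isEdge< G i j ≡ true → Gen₂ (X k ⊗ edgePoly i j)

  data Gen₃ : Poly n → Set where
    edge : ∀ {i j} → isEdge< G i j ≡ true → Gen₃ (edgeCubic i j)
    triple : ∀ {i j k} → isEdge< G i j ≡ true → neq k i ≡ true → neq k j ≡ true → Gen₃ (edgeTriple i j k)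

  data Gen₄ : Poly n → Set where
    edge : ∀ {i j} → isEdge< G i j ≡ true → Gen₄ (edgeCubic i j)
    path : ∀ {i j k} → adj G i j ≡ true → adj G j k ≡ true → Gen₄ (pathPoly i j k)

  isEdge : Fin n → Fin n → List Bool
  isEdge i j = isEdge< G i j ∷ []

  isEdge₃ : Fin n → Fin n → Fin n → List Bool
  isEdge₃ i j _ = isEdge i j

  isTriple : Fin n → Fin n → Fin n → List Bool
  isTriple i j k = isEdge< G i j ∷ neq k i ∷ neq k j ∷ []

  isPath : Fin n → Fin n → Fin n → List Bool
  isPath i j k = adj G i j ∷ adj G j k ∷ []

  edgeMultiple : Fin n → Fin n → Fin n → Poly n
  edgeMultiple i j k = X k ⊗ edgePoly i j

  vertexFamily multipleFamily edgeFamily tripleFamily pathFamily : LinearFamily {n}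
  vertexFamily = guarded₁ (λ _ → []) vertexPoly
  multipleFamily = guarded₃ isEdge₃ edgeMultiple
  edgeFamily = guarded₂ isEdge edgeCubic
  tripleFamily = guarded₃ isTriple edgeTriple
  pathFamily = guarded₃ isPath pathPoly

  condition2⇔span : Condition2 G ⇔ Span Gen₂ 𝟙
  condition2⇔span = ⇔-trans (combination⇔image vertexFamily multipleFamily)
    (image⇔span (vertexFamily ⊕ᴸ multipleFamily)
      (⊕ᴸ-spanned vertexFamily multipleFamily
        (guarded₁-spanned (λ _ → []) vertexPoly λ i _ → vertex i)
        (guarded₃-spanned isEdge₃ edgeMultiple λ { i j k (e ∷ []) → edge k e }))
      λ where
      (vertex i) → ⊕ᴸ-imageˡ vertexFamily multipleFamily (guarded₁-image (λ _ → []) vertexPoly [])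
      (edge k e) → ⊕ᴸ-imageʳ vertexFamily multipleFamily (guarded₃-image isEdge₃ edgeMultiple (e ∷ [])))

  condition3⇔span : Condition3 G ⇔ Span Gen₃ 𝟙
  condition3⇔span = ⇔-trans (combination⇔image edgeFamily tripleFamily)
    (image⇔span (edgeFamily ⊕ᴸ tripleFamily)
      (⊕ᴸ-spanned edgeFamily tripleFamily
        (guarded₂-spanned isEdge edgeCubic λ { i j (e ∷ []) → edge e })
        (guarded₃-spanned isTriple edgeTriple λ { i j k (e ∷ k≢i ∷ k≢j ∷ []) → triple e k≢i k≢j }))
      λ where
      (edge e) → ⊕ᴸ-imageˡ edgeFamily tripleFamily (guarded₂-image isEdge edgeCubic (e ∷ []))
      (triple e k≢i k≢j) →
        ⊕ᴸ-imageʳ edgeFamily tripleFamily (guarded₃-image isTriple edgeTriple (e ∷ k≢i ∷ k≢j ∷ [])))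

  condition4⇔span : Condition4 G ⇔ Span Gen₄ 𝟙
  condition4⇔span = ⇔-trans (combination⇔image edgeFamily pathFamily)
    (image⇔span (edgeFamily ⊕ᴸ pathFamily)
      (⊕ᴸ-spanned edgeFamily pathFamily
        (guarded₂-spanned isEdge edgeCubic λ { i j (e ∷ []) → edge e })
        (guarded₃-spanned isPath pathPoly λ { i j k (ij ∷ jk ∷ []) → path ij jk }))
      λ where
      (edge e) → ⊕ᴸ-imageˡ edgeFamily pathFamily (guarded₂-image isEdge edgeCubic (e ∷ []))
      (path ij jk) → ⊕ᴸ-imageʳ edgeFamily pathFamily (guarded₃-image isPath pathPoly (ij ∷ jk ∷ [])))

  gen₃⊆span₂ : ∀ {g} → Gen₃ g → Span Gen₂ g
  gen₃⊆span₂ (edge {i} {j} e) =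
    span-≋ (edgeCubic≋ i j) (span-gen-⊕ (vertex i) (span-gen (edge i e) ≋-refl))
  gen₃⊆span₂ (triple {i} {j} {k} e _ _) = span-gen (edge k e) (≡⇒≋ (edgeMultiple≡edgeTriple k i j))

  adj-≢ : ∀ {a b} → adj G a b ≡ true → a ≢ b
  adj-≢ {a} ab refl with trans (sym ab) (irrefl G a)
  ... | ()

  ≢⇒neq : ∀ {a b : Fin n} → a ≢ b → neq a b ≡ true
  ≢⇒neq a≢b = cong not (δ-≢ a≢b)

  adj⇒isEdge< : ∀ {a b} → adj G a b ≡ true → isEdge< G a b ≡ true ⊎ isEdge< G b a ≡ true
  adj⇒isEdge< {a} {b} ab with ℕ.<-cmp (toℕ a) (toℕ b)
  ... | tri< a<b _ _ = inj₁ (cong₂ _∧_ ab (Equivalence.to Bool.T-≡ (ℕ.<⇒<ᵇ a<b)))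
  ... | tri≈ _ a≡b _ = ⊥-elim (adj-≢ ab (Fin.toℕ-injective a≡b))
  ... | tri> _ _ b<a =
    inj₂ (cong₂ _∧_ (trans (SimpleGraph.sym G b a) ab) (Equivalence.to Bool.T-≡ (ℕ.<⇒<ᵇ b<a)))

  edgeTriple∈span₃ : ∀ {a b c} → adj G a b ≡ true → neq c a ≡ true → neq c b ≡ true →
                     Span Gen₃ (edgeTriple a b c)
  edgeTriple∈span₃ {a} {b} {c} ab ca cb with adj⇒isEdge< ab
  ... | inj₁ a<b = span-gen (triple a<b ca cb) ≋-refl
  ... | inj₂ b<a = span-gen (triple b<a cb ca) (edgeTriple-swap b a c)

  gen₄⊆span₃ : ∀ {g} → Gen₄ g → Span Gen₃ g
  gen₄⊆span₃ (edge e) = span-gen (edge e) ≋-refl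
  gen₄⊆span₃ (path {i} {j} {k} ij jk) with i Fin.≟ k
  ... | yes refl = span-≋𝟘 (pathPoly-loop≋𝟘 i j)
  ... | no i≢k = span-≋ (≋-sym (pathPoly≋ i j k))
    (span-⊕ (edgeTriple∈span₃ ij (≢⇒neq (i≢k ∘ sym)) (≢⇒neq (adj-≢ jk ∘ sym)))
            (edgeTriple∈span₃ jk (≢⇒neq (adj-≢ ij)) (≢⇒neq i≢k)))

-- The linear map τ for (2) ⇒ (4)

module Resolution {n : ℕ} (G : SimpleGraph n) where
  open Generators G

  -- τ(x_a x_b x_c) for a < b < c, determined by the first edge among ab, bc, ac.
  squarefreeImage : Bool → Bool → Bool → Fin n → Fin n → Fin n → Poly n
  squarefreeImage true _ _ a b c = X a ⊗ X a ⊗ X c ⊕ X b ⊗ X b ⊗ X c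
  squarefreeImage false true _ a b c = X b ⊗ X b ⊗ X a ⊕ X c ⊗ X c ⊗ X a
  squarefreeImage false false true a b c = X a ⊗ X a ⊗ X b ⊕ X c ⊗ X c ⊗ X b
  squarefreeImage false false false a b c = 𝟘

  -- τ(x_a x_b x_c) for a ≤ b ≤ c, given whether a = b and whether b = c.
  cubicImage : Bool → Bool → Fin n → Fin n → Fin n → Poly n
  cubicImage true true a b c = 𝟙
  cubicImage true false a b c = X a ⊗ X a ⊗ X c
  cubicImage false true a b c = X b ⊗ X b ⊗ X a
  cubicImage false false a b c = squarefreeImage (adj G a b) (adj G b c) (adj G a c) a b c

  imageOfSupport : List (Fin n) → Poly n
  imageOfSupport [] = 𝟙
  imageOfSupport (a ∷ b ∷ c ∷ []) = cubicImage (δ a b) (δ b c) a b c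
  imageOfSupport _ = 𝟘

  -- Read off the sorted support: τ fixes 1 and every x_a² x_b, sends x_a³ to 1 and kills all
  -- monomials of degree other than 0 and 3.
  τ : Monomial n → Poly n
  τ m = imageOfSupport (support m)

  τ-sorted : ∀ {a b c} → a ≤ᶠ b → b ≤ᶠ c → τ (cubic a b c) ≡ cubicImage (δ a b) (δ b c) a b c
  τ-sorted a≤b b≤c = cong imageOfSupport (support-cubic a≤b b≤c)

  τ-cube : ∀ a → τ (cubic a a a) ≡ 𝟙
  τ-cube a = trans (τ-sorted (Fin.≤-refl {x = a}) (Fin.≤-refl {x = a}))
                   (cong₂ (λ x y → cubicImage x y a a a) (δ-refl a) (δ-refl a))

  τ-aab : ∀ {a b} → a <ᶠ b → τ (cubic a a b) ≡ X a ⊗ X a ⊗ X b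
  τ-aab {a} {b} a<b = trans (τ-sorted (Fin.≤-refl {x = a}) (ℕ.<⇒≤ a<b))
                            (cong₂ (λ x y → cubicImage x y a a b) (δ-refl a) (δ-≢ (Fin.<⇒≢ a<b)))

  τ-abb : ∀ {a b} → a <ᶠ b → τ (cubic a b b) ≡ X b ⊗ X b ⊗ X a
  τ-abb {a} {b} a<b = trans (τ-sorted (ℕ.<⇒≤ a<b) (Fin.≤-refl {x = b}))
                            (cong₂ (λ x y → cubicImage x y a b b) (δ-≢ (Fin.<⇒≢ a<b)) (δ-refl b))

  τ-abc : ∀ {a b c} → a <ᶠ b → b <ᶠ c →
          τ (cubic a b c) ≡ squarefreeImage (adj G a b) (adj G b c) (adj G a c) a b c
  τ-abc {a} {b} {c} a<b b<c = trans (τ-sorted (ℕ.<⇒≤ a<b) (ℕ.<⇒≤ b<c))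
    (cong₂ (λ x y → cubicImage x y a b c) (δ-≢ (Fin.<⇒≢ a<b)) (δ-≢ (Fin.<⇒≢ b<c)))


  MapsIntoSpan₄ : Fin n → Fin n → Fin n → Set
  MapsIntoSpan₄ k i j = Span Gen₄ (linearMap τ (cubic k i i ∷ cubic k i j ∷ cubic k j j ∷ []))

  τ-multiple-below : ∀ {i j k} → adj G i j ≡ true → k <ᶠ i → i <ᶠ j → MapsIntoSpan₄ k i j
  τ-multiple-below {i} {j} {k} ij k<i i<j
    rewrite τ-abb k<i | τ-abc k<i i<j | τ-abb (Fin.<-trans k<i i<j) | ij with adj G k i in ki
  ... | true = span-gen (path ki ij)
    (≋-trans (≡⇒≋ (pathPoly-cubics k i j)) (≋-byParity (cubic k k j ∷ cubic i i j ∷ cubic i i k ∷ cubic j j k ∷ [])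
                (# 0 ∷ # 1 ∷ # 2 ∷ # 3 ∷ []) (# 2 ∷ # 0 ∷ # 1 ∷ # 3 ∷ [])))
  ... | false = span-≋𝟘 (pairs≋𝟘 i j k)

  τ-multiple-left : ∀ {i j} → isEdge< G i j ≡ true → i <ᶠ j → MapsIntoSpan₄ i i j
  τ-multiple-left {i} {j} e i<j rewrite τ-cube i | τ-aab i<j | τ-abb i<j =
    span-gen (edge e) (≋-trans (≡⇒≋ (edgeCubic-cubics i j))
      (≋-byParity (cubic i i j ∷ cubic j j i ∷ one n ∷ []) (# 0 ∷ # 1 ∷ # 2 ∷ []) (# 2 ∷ # 0 ∷ # 1 ∷ [])))

  τ-multiple-between : ∀ {i j k} → adj G i j ≡ true → i <ᶠ k → k <ᶠ j → MapsIntoSpan₄ k i j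
  τ-multiple-between {i} {j} {k} ij i<k k<j
    rewrite cubic-rotate k i i | cubic-swap₁₂ k i j | τ-aab i<k | τ-abc i<k k<j | τ-abb k<j | ij
    with adj G i k in ik | adj G k j in kj
  ... | true | _ = span-gen (path (trans (SimpleGraph.sym G k i) ik) ij)
    (≋-trans (≡⇒≋ (pathPoly-cubics k i j)) (≋-byParity (cubic k k j ∷ cubic i i j ∷ cubic i i k ∷ cubic j j k ∷ [])
                (# 0 ∷ # 1 ∷ # 2 ∷ # 3 ∷ []) (# 2 ∷ # 1 ∷ # 0 ∷ # 3 ∷ [])))
  ... | false | true = span-gen (path ij (trans (SimpleGraph.sym G j k) kj))
    (≋-trans (≡⇒≋ (pathPoly-cubics i j k)) (≋-byParity (cubic i i k ∷ cubic j j k ∷ cubic j j i ∷ cubic k k i ∷ [])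
                (# 0 ∷ # 1 ∷ # 2 ∷ # 3 ∷ []) (# 0 ∷ # 3 ∷ # 2 ∷ # 1 ∷ [])))
  ... | false | false = span-≋𝟘 (pairs≋𝟘 i j k)

  τ-multiple-right : ∀ {i j} → isEdge< G i j ≡ true → i <ᶠ j → MapsIntoSpan₄ j i j
  τ-multiple-right {i} {j} e i<j
    rewrite cubic-rotate j i i | cubic-swap₁₂ j i j | τ-aab i<j | τ-abb i<j | τ-cube j =
    span-gen (edge e) (≡⇒≋ (edgeCubic-cubics i j))

  τ-multiple-above : ∀ {i j k} → adj G i j ≡ true → i <ᶠ j → j <ᶠ k → MapsIntoSpan₄ k i j
  τ-multiple-above {i} {j} {k} ij i<j j<k
    rewrite cubic-rotate k i i | cubic-rotate k i j | cubic-rotate k j j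
          | τ-aab (Fin.<-trans i<j j<k) | τ-abc i<j j<k | τ-aab j<k | ij = span-≋𝟘 (pairs≋𝟘 i j k)

  τ-one : τ (one n) ≡ 𝟙
  τ-one = cong imageOfSupport (support-one n)

  τ-multiple : ∀ {i j} k → isEdge< G i j ≡ true → MapsIntoSpan₄ k i j
  τ-multiple {i} {j} k e with ∧≡true {adj G i j} e
  ... | ij , i≺j
    with ℕ.<ᵇ⇒< (toℕ i) (toℕ j) (Equivalence.from Bool.T-≡ i≺j) | Fin.<-cmp k i | Fin.<-cmp k j
  ... | i<j | tri< k<i _ _ | _ = τ-multiple-below ij k<i i<j
  ... | i<j | tri≈ _ refl _ | _ = τ-multiple-left e i<j
  ... | i<j | tri> _ _ i<k | tri< k<j _ _ = τ-multiple-between ij i<k k<j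
  ... | i<j | tri> _ _ _ | tri≈ _ refl _ = τ-multiple-right e i<j
  ... | i<j | tri> _ _ _ | tri> _ _ j<k = τ-multiple-above ij i<j j<k

  τ-gen₂∈span₄ : ∀ {g} → Gen₂ g → Span Gen₄ (linearMap τ g)
  τ-gen₂∈span₄ (vertex i) rewrite τ-cube i | τ-one = span-≋𝟘 (⊕-self 𝟙)
  τ-gen₂∈span₄ (edge {i} {j} k e) =
    subst (Span Gen₄) (cong (linearMap τ) (sym (edgeMultiple-cubics k i j))) (τ-multiple k e)

  span₂⇒span₄ : Span Gen₂ 𝟙 → Span Gen₄ 𝟙
  span₂⇒span₄ s =
    span-≋ (≡⇒≋ (trans (List.++-identityʳ (τ (one n))) τ-one)) (span-linearMap τ τ-gen₂∈span₄ s)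

-- Nullstellensatz certificates

isDegree0or3 : ℕ → Bool
isDegree0or3 0 = true
isDegree0or3 3 = true
isDegree0or3 _ = false

module _ {n : ℕ} where

  infixl 7 _*ₘ_
  _*ₘ_ : Monomial n → Poly n → Poly n
  m *ₘ p = map (m ·_) p

  one-*ₘ : ∀ p → one n *ₘ p ≡ p
  one-*ₘ p = trans (List.map-cong one-· p) (List.map-id p)

  coeff-filter : ∀ {P : Monomial n → Set} (P? : Decidable P) p m →
                 coeff (filter P? p) m ≡ does (P? m) ∧ coeff p m
  coeff-filter P? [] m = sym (∧-zeroʳ _)
  coeff-filter P? (x ∷ p) m with does (P? x) in Px
  ... | true = begin
    coeff (x ∷ filter P? p) m                      ≡⟨ coeff-∷ x (filter P? p) m ⟩
    same x m xor coeff (filter P? p) m             ≡⟨ cong (same x m xor_) (coeff-filter P? p m) ⟩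
    same x m xor (does (P? m) ∧ coeff p m)         ≡⟨ lemma (same x m) (does (P? m)) (coeff p m) Pm ⟩
    does (P? m) ∧ (same x m xor coeff p m)         ≡⟨ cong (does (P? m) ∧_) (coeff-∷ x p m) ⟨
    does (P? m) ∧ coeff (x ∷ p) m                  ∎
    where
    open ≡-Reasoning
    Pm : same x m ≡ true → does (P? m) ≡ true
    Pm s = subst (λ y → does (P? y) ≡ true) (same-true s) Px
    lemma : ∀ s D q → (s ≡ true → D ≡ true) → s xor (D ∧ q) ≡ D ∧ (s xor q)
    lemma false D q _ = refl
    lemma true D q D≡true rewrite D≡true refl = refl
  ... | false = begin
    coeff (filter P? p) m                          ≡⟨ coeff-filter P? p m ⟩
    does (P? m) ∧ coeff p m                        ≡⟨ lemma (same x m) (does (P? m)) (coeff p m) Pm ⟩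
    does (P? m) ∧ (same x m xor coeff p m)         ≡⟨ cong (does (P? m) ∧_) (coeff-∷ x p m) ⟨
    does (P? m) ∧ coeff (x ∷ p) m                  ∎
    where
    open ≡-Reasoning
    Pm : same x m ≡ true → does (P? m) ≡ false
    Pm s = subst (λ y → does (P? y) ≡ false) (same-true s) Px
    lemma : ∀ s D q → (s ≡ true → D ≡ false) → D ∧ q ≡ D ∧ (s xor q)
    lemma false D q _ = refl
    lemma true D q D≡false rewrite D≡false refl = refl

  lowDegreePart : ℕ → Poly n → Poly n
  lowDegreePart d = filter (λ m → totalDegree m ℕ.≤? d)

  ≋-lowDegreePart : ∀ {d p} → DegreeAtMost d p → p ≋ lowDegreePart d p
  ≋-lowDegreePart {d} {p} deg≤d = coeffwise λ m →
    sym (trans (coeff-filter (λ m → totalDegree m ℕ.≤? d) p m) (low m))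
    where
    low : ∀ m → does (totalDegree m ℕ.≤? d) ∧ coeff p m ≡ coeff p m
    low m with coeff p m in pm
    ... | false = ∧-zeroʳ _
    ... | true = trans (∧-identityʳ _) (dec-true (totalDegree m ℕ.≤? d) (deg≤d m pm))

  hasDegree0or3 : Monomial n → Bool
  hasDegree0or3 m = isDegree0or3 (totalDegree m)

  projection : Monomial n → Poly n
  projection m = if hasDegree0or3 m then m ∷ [] else []

module Certificates {n : ℕ} (G : SimpleGraph n) where
  open Generators G

  data BayerMultiple (d : ℕ) : Poly n → Set where
    vertex : ∀ {m} i → totalDegree m ≤ d → BayerMultiple d (m *ₘ vertexPoly i)
    edge : ∀ {m i j} → isEdge< G i j ≡ true → totalDegree m ≤ d → BayerMultiple d (m *ₘ edgePoly i j)

  multiples∈span : ∀ {d f p} → (∀ {m} → totalDegree m ≤ d → BayerMultiple d (m *ₘ f)) →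
                   DegreeAtMost d p → Span (BayerMultiple d) (p ⊗ f)
  multiples∈span {d} {f} {p} multiple deg≤d =
    span-≋ (≋-sym (linearMap-resp (_*ₘ f) (≋-lowDegreePart {p = p} deg≤d)))
           (span-linearMap-All (_*ₘ f) (λ deg≤d → span-gen (multiple deg≤d) ≋-refl)
                               (All.all-filter (λ m → totalDegree m ℕ.≤? d) p))

  certificate⇒span : ∀ {d} → HasCertificateOfDegreeAtMost G d → Span (BayerMultiple d) 𝟙
  certificate⇒span (α , β , α-deg , β-deg , 𝟙≈) = span-≋ (≋-sym (coeffwise 𝟙≈))
    (span-⊕ (span-ΣFin _ λ i → multiples∈span {p = α i} (vertex i) (α-deg i))
            (span-ΣFin _ λ i → span-ΣFin _ λ j → edgeTerm i j))
    where
    edgeTerm : ∀ i j → Span (BayerMultiple _) (scal (isEdge< G i j) (β i j ⊗ edgePoly i j))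
    edgeTerm i j with isEdge< G i j in e
    ... | true = multiples∈span {p = β i j} (edge e) (β-deg i j)
    ... | false = span-𝟘

  degree0or3Parity : Poly n → Bool
  degree0or3Parity = linearForm hasDegree0or3

  vertexPoly-parity : ∀ (i : Fin n) → degree0or3Parity (vertexPoly i) ≡ false
  vertexPoly-parity i rewrite totalDegree-cubic i i i | totalDegree-one n = refl

  edgePoly-parity : ∀ (i j : Fin n) → degree0or3Parity (edgePoly i j) ≡ false
  edgePoly-parity i j rewrite totalDegree-quadratic i i | totalDegree-quadratic i j | totalDegree-quadratic j j = refl

  multiple₀-parity : ∀ {g} → BayerMultiple 0 g → degree0or3Parity g ≡ false
  multiple₀-parity (vertex {m} i deg≤0) with refl ← totalDegree≡0 m (ℕ.n≤0⇒n≡0 deg≤0) =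
    trans (cong degree0or3Parity (one-*ₘ (vertexPoly i))) (vertexPoly-parity i)
  multiple₀-parity (edge {m} {i} {j} _ deg≤0) with refl ← totalDegree≡0 m (ℕ.n≤0⇒n≡0 deg≤0) =
    trans (cong degree0or3Parity (one-*ₘ (edgePoly i j))) (edgePoly-parity i j)

  no-certificate₀ : ¬ HasCertificateOfDegreeAtMost G 0
  no-certificate₀ cert with trans (sym (linearForm-span hasDegree0or3 multiple₀-parity (certificate⇒span cert)))
                                  (cong (λ d → isDegree0or3 d xor false) (totalDegree-one n))
  ... | ()

  projection-vertexPoly : ∀ (i : Fin n) → linearMap projection (vertexPoly i) ≡ vertexPoly i
  projection-vertexPoly i rewrite totalDegree-cubic i i i | totalDegree-one n = refl

  projection-edgePoly : ∀ (i j : Fin n) → linearMap projection (edgePoly i j) ≡ 𝟘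
  projection-edgePoly i j
    rewrite totalDegree-quadratic i i | totalDegree-quadratic i j | totalDegree-quadratic j j = refl

  projection-x-vertexPoly : ∀ (k i : Fin n) → linearMap projection (unit k *ₘ vertexPoly i) ≡ 𝟘
  projection-x-vertexPoly k i
    rewrite totalDegree-unit-· k (cubic i i i) | totalDegree-cubic i i i
          | totalDegree-unit-· k (one n) | totalDegree-one n = refl

  projection-x-edgePoly : ∀ (k i j : Fin n) → linearMap projection (unit k *ₘ edgePoly i j) ≡ X k ⊗ edgePoly i j
  projection-x-edgePoly k i j
    rewrite totalDegree-unit-· k (quadratic i i) | totalDegree-unit-· k (quadratic i j)
          | totalDegree-unit-· k (quadratic j j) | totalDegree-quadratic i i | totalDegree-quadratic i j | totalDegree-quadratic j j = refl

  projection-multiple₁∈span₂ : ∀ {g} → BayerMultiple 1 g → Span Gen₂ (linearMap projection g)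
  projection-multiple₁∈span₂ (vertex {m} i deg≤1) with totalDegree≤1 m deg≤1
  ... | inj₁ refl = span-gen (vertex i)
    (≡⇒≋ (sym (trans (cong (linearMap projection) (one-*ₘ (vertexPoly i))) (projection-vertexPoly i))))
  ... | inj₂ (k , refl) = span-≋𝟘 (≡⇒≋ (projection-x-vertexPoly k i))
  projection-multiple₁∈span₂ (edge {m} {i} {j} e deg≤1) with totalDegree≤1 m deg≤1
  ... | inj₁ refl =
    span-≋𝟘 (≡⇒≋ (trans (cong (linearMap projection) (one-*ₘ (edgePoly i j))) (projection-edgePoly i j)))
  ... | inj₂ (k , refl) = span-gen (edge k e) (≡⇒≋ (sym (projection-x-edgePoly k i j)))

  certificate₁⇒span₂ : HasCertificateOfDegreeAtMost G 1 → Span Gen₂ 𝟙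
  certificate₁⇒span₂ cert =
    span-≋ (≡⇒≋ projection-𝟙) (span-linearMap projection projection-multiple₁∈span₂ (certificate⇒span cert))
    where
    projection-𝟙 : linearMap projection 𝟙 ≡ 𝟙
    projection-𝟙 = cong (λ d → (if isDegree0or3 d then one n ∷ [] else []) ++ []) (totalDegree-one n)

  singleton-coeff : ∀ {x m : Monomial n} → coeff (x ∷ []) m ≡ true → x ≡ m
  singleton-coeff {x} {m} eq = same-true (trans (sym (xor-identityʳ (same x m))) (trans (sym (coeff-∷ x [] m)) eq))

  constant-degree : ∀ c → DegreeAtMost 1 (scal c (𝟙 {n}))
  constant-degree true m eq =
    subst (λ x → totalDegree x ≤ 1) (singleton-coeff eq) (subst (_≤ 1) (sym (totalDegree-one n)) z≤n)

  linear-degree : ∀ (f : Fin n → Bool) → DegreeAtMost 1 (ΣFin λ k → scal (f k) (X k))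
  linear-degree f m eq with sum-true _ (trans (sym (coeff-ΣFin _ m)) eq)
  ... | k , fk with f k
  ... | true = subst (λ x → totalDegree x ≤ 1) (singleton-coeff fk) (ℕ.≤-reflexive (totalDegree-unit k))

  condition2⇒certificate₁ : Condition2 G → HasCertificateOfDegreeAtMost G 1
  condition2⇒certificate₁ (a , b , 𝟙≈) =
    α , β , (λ i → constant-degree (a i)) , (λ i j → linear-degree (b i j)) , coeff-≡ 𝟙≋
    where
    α : Fin n → Poly n
    α i = scal (a i) 𝟙
    β : Fin n → Fin n → Poly n
    β i j = ΣFin λ k → scal (b i j k) (X k)
    vertexTerm : ∀ i → scal (a i) (vertexPoly i) ≋ α i ⊗ vertexPoly i
    vertexTerm i with a i
    ... | true = ≡⇒≋ (sym (trans (List.++-identityʳ _) (one-*ₘ (vertexPoly i))))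
    ... | false = ≋-refl
    edgeTerm : ∀ i j → ΣFin (λ k → scal (isEdge< G i j ∧ b i j k) (X k ⊗ edgePoly i j))
                     ≋ scal (isEdge< G i j) (β i j ⊗ edgePoly i j)
    edgeTerm i j with isEdge< G i j
    ... | true = ≋-sym (≋-trans (≡⇒≋ (linearMap-ΣFin (_*ₘ edgePoly i j) _))
                                (ΣFin-cong λ k → ≡⇒≋ (linearMap-scal (_*ₘ edgePoly i j) (b i j k) (X k))))
    ... | false = ΣFin-𝟘 _ λ _ → ≋-refl
    𝟙≋ : 𝟙 ≋ ΣFin (λ i → α i ⊗ vertexPoly i)
           ⊕ ΣFin (λ i → ΣFin λ j → scal (isEdge< G i j) (β i j ⊗ edgePoly i j))
    𝟙≋ = ≋-trans (coeffwise 𝟙≈) (⊕-cong (ΣFin-cong vertexTerm) (ΣFin-cong λ i → ΣFin-cong (edgeTerm i)))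

  N≡1⇔condition2 : NEqualsOne G ⇔ Condition2 G
  N≡1⇔condition2 = mk⇔ (λ (cert₁ , _) → Equivalence.from condition2⇔span (certificate₁⇒span₂ cert₁))
                        (λ c → condition2⇒certificate₁ c , no-certificate₀)

proposition2p1 : (n : ℕ) (G : SimpleGraph n) →
    (NEqualsOne G ⇔ Condition2 G) × (NEqualsOne G ⇔ Condition3 G) × (NEqualsOne G ⇔ Condition4 G)
proposition2p1 n G =
    N≡1⇔condition2
  , (N≡1⇔condition2 ⟨ ⇔-trans ⟩ condition2⇔span ⟨ ⇔-trans ⟩ span₂⇔span₃
                    ⟨ ⇔-trans ⟩ ⇔-sym condition3⇔span)
  , (N≡1⇔condition2 ⟨ ⇔-trans ⟩ condition2⇔span ⟨ ⇔-trans ⟩ span₂⇔span₄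
                    ⟨ ⇔-trans ⟩ ⇔-sym condition4⇔span)
  where
  open Generators G
  open Resolution G
  open Certificates G
  span₂⇔span₃ : Span Gen₂ 𝟙 ⇔ Span Gen₃ 𝟙
  span₂⇔span₃ = mk⇔ (span-mono gen₄⊆span₃ ∘ span₂⇒span₄) (span-mono gen₃⊆span₂)
  span₂⇔span₄ : Span Gen₂ 𝟙 ⇔ Span Gen₄ 𝟙
  span₂⇔span₄ = mk⇔ span₂⇒span₄ (span-mono gen₃⊆span₂ ∘ span-mono gen₄⊆span₃)
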